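{- We have $\operatorname{SU}(1,1)(\mathbb{Z})=\operatorname{SL}_{2}(\mathbb{Z})$ and $\operatorname{U}(1,1)(\mathbb{Z})=\mu_{\mathbb{K}}\cdot\operatorname{SL}_{2}(\mathbb{Z})$, where $\mu_{\mathbb{K}}$ is the group of roots of unity in $\mathbb{K}$, viewed as scalar $2\times2$ matrices.
   Context: Let $\mathbb{K}\subset\mathbb{C}$ be an imaginary quadratic field with ring of integers $\mathcal{O}_{\mathbb{K}}$. $\operatorname{U}(1,1)(\mathbb{Z})$ is the group of matrices $A\in\operatorname{GL}_{2}(\mathcal{O}_{\mathbb{K}})$ satisfying $A\begin{pmatrix}0&-1\\1&0\end{pmatrix}A^{*}=\begin{pmatrix}0&-1\\1&0\end{pmatrix}$, where $A^{*}=\overline{A}^{t}$ is the conjugate transpose, and $\operatorname{SU}(1,1)(\mathbb{Z})$ is its subgroup of matrices of determinant $1$. -}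

module Defs where

open import Data.Nat as ℕ using (ℕ; _≤_; _%_)
import Data.Nat.DivMod as ℕD
open import Data.Nat.Divisibility using (_∣_)
open import Data.Integer as ℤ using (ℤ; +_)
open import Data.Product using (Σ; ∃; _×_; _,_)
open import Relation.Binary.PropositionalEquality using (_≡_)
open import Relation.Nullary using (yes; no)

SquareFree : ℕ → Set
SquareFree d = ∀ (m : ℕ) → (m ℕ.* m) ∣ d → m ≡ 1

-- The imaginary quadratic field K = ℚ(√-d), d ≥ 1 squarefree.
-- O_K = ℤ[ω] with ω = (1+√-d)/2 if d ≡ 3 (mod 4) (i.e. -d ≡ 1 mod 4),
-- and ω = √-d otherwise.  ω satisfies ω² = tr·ω − nm with
--   tr = 1, nm = (d+1)/4   if d ≡ 3 (mod 4)
--   tr = 0, nm = d         otherwise.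
module OK (d : ℕ) where

  tr : ℤ
  tr with d % 4 ℕ.≟ 3
  ... | yes _ = + 1
  ... | no _  = + 0

  nm : ℤ
  nm with d % 4 ℕ.≟ 3
  ... | yes _ = + ((d ℕ.+ 1) ℕD./ 4)
  ... | no _  = + d

  -- element a + b ω of O_K (unique representation)
  record 𝒪 : Set where
    constructor mk
    field
      re : ℤ
      im : ℤ
  open 𝒪 public

  infixl 6 _+ₒ_
  infixl 7 _*ₒ_

  _+ₒ_ : 𝒪 → 𝒪 → 𝒪
  mk a b +ₒ mk c e = mk (a ℤ.+ c) (b ℤ.+ e)

  -ₒ_ : 𝒪 → 𝒪
  -ₒ mk a b = mk (ℤ.- a) (ℤ.- b)

  _*ₒ_ : 𝒪 → 𝒪 → 𝒪
  mk a b *ₒ mk c e =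
    mk (a ℤ.* c ℤ.- nm ℤ.* (b ℤ.* e))
       (a ℤ.* e ℤ.+ b ℤ.* c ℤ.+ tr ℤ.* (b ℤ.* e))

  -- complex conjugation: conj(ω) = tr − ω
  conj : 𝒪 → 𝒪
  conj (mk a b) = mk (a ℤ.+ tr ℤ.* b) (ℤ.- b)

  0ₒ 1ₒ : 𝒪
  0ₒ = mk (+ 0) (+ 0)
  1ₒ = mk (+ 1) (+ 0)

  ι : ℤ → 𝒪
  ι a = mk a (+ 0)

  _^ₒ_ : 𝒪 → ℕ → 𝒪
  x ^ₒ ℕ.zero  = 1ₒ
  x ^ₒ ℕ.suc n = x *ₒ (x ^ₒ n)

  -- roots of unity in K (they lie in O_K)
  RootOfUnity : 𝒪 → Set
  RootOfUnity ζ = Σ ℕ λ n → (1 ≤ n) × (ζ ^ₒ n ≡ 1ₒ)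

  record Mat : Set where
    constructor mat
    field
      m11 m12 m21 m22 : 𝒪
  open Mat public

  infixl 7 _·_
  _·_ : Mat → Mat → Mat
  mat a b c e · mat a' b' c' e' =
    mat (a *ₒ a' +ₒ b *ₒ c') (a *ₒ b' +ₒ b *ₒ e')
        (c *ₒ a' +ₒ e *ₒ c') (c *ₒ b' +ₒ e *ₒ e')

  _* : Mat → Mat
  mat a b c e * = mat (conj a) (conj c) (conj b) (conj e)

  det : Mat → 𝒪
  det (mat a b c e) = a *ₒ e +ₒ -ₒ (b *ₒ c)

  I₂ J : Mat
  I₂ = mat 1ₒ 0ₒ 0ₒ 1ₒ
  J  = mat 0ₒ (-ₒ 1ₒ) 1ₒ 0ₒ

  scal : 𝒪 → Mat → Mat
  scal ζ (mat a b c e) = mat (ζ *ₒ a) (ζ *ₒ b) (ζ *ₒ c) (ζ *ₒ e)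

  GL₂ : Mat → Set
  GL₂ A = Σ Mat λ B → (A · B ≡ I₂) × (B · A ≡ I₂)

  U11 : Mat → Set
  U11 A = GL₂ A × ((A · J) · (A *) ≡ J)

  SU11 : Mat → Set
  SU11 A = U11 A × (det A ≡ 1ₒ)

  SL₂ℤ : Mat → Set
  SL₂ℤ A = (Σ ℤ λ a → Σ ℤ λ b → Σ ℤ λ c → Σ ℤ λ e →
              A ≡ mat (ι a) (ι b) (ι c) (ι e))
           × (det A ≡ 1ₒ)

-- Write u = det A. The relation A J Aᴴ = J forces u ū = 1 and x = u x̄ for every entry x of A.
-- If u = ζ² for a root of unity ζ, the entries of ζ̄ A are fixed by conjugation, hence integral,
-- and det (ζ̄ A) = 1, so A = ζ B with B ∈ SL₂(ℤ); for u = 1 this gives SU(1,1)(ℤ) = SL₂(ℤ).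
-- Going through the units of 𝒪, the remaining values (u = -1 unless d = 1, u = ±i for d = 1,
-- u = ω, ω⁵ for d = 3) are impossible: the solutions of x = u x̄ are then the integer multiples
-- of a single ρ with ρ² = m u and |m| > 1, so det A ∈ ℤ ρ² = m ℤ u cannot be u.

module Submission where

open import Defs
open import Data.Nat as ℕ using (ℕ; _≤_; z≤n; s≤s; _%_; _/_)
import Data.Nat.Properties as ℕP
open import Data.Nat.DivMod using (m≡m%n+[m/n]*n; m*n/n≡m)
open import Data.Integer using (ℤ; +_; -[1+_]; ∣_∣; _+_; _*_; -_; _-_; _^_; _≟_)
import Data.Integer.Properties as ℤP
open import Data.Integer.Tactic.RingSolver using (solve-∀)
open import Data.Product using (Σ; _×_; _,_; proj₁; proj₂)
open import Data.Sum as Sum using (_⊎_; inj₁; inj₂; [_,_]′)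
open import Data.Empty using (⊥; ⊥-elim)
open import Data.Maybe using (Maybe; just; nothing)
open import Relation.Nullary using (¬_; yes; no; Dec)
open import Relation.Binary.PropositionalEquality hiding (J)
open import Algebra.Bundles using (CommutativeRing)
open import Algebra.Structures using (IsCommutativeRing)
import Algebra.Solver.Ring.AlmostCommutativeRing as ACR
open import Function.Bundles using (_⇔_; mk⇔)
open ≡-Reasoning

∣_∣² : ℤ → ℕ
∣ i ∣² = ∣ i ∣ ℕ.* ∣ i ∣

i*i≡+∣i∣² : ∀ i → i * i ≡ + ∣ i ∣²
i*i≡+∣i∣² (+ m)    = ℤP.+◃n≡+n (m ℕ.* m)
i*i≡+∣i∣² -[1+ m ] = refl

∣i∣²≡0⇒i≡0 : ∀ i → ∣ i ∣² ≡ 0 → i ≡ + 0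
∣i∣²≡0⇒i≡0 i eq = [ ℤP.∣i∣≡0⇒i≡0 , ℤP.∣i∣≡0⇒i≡0 ]′ (ℕP.m*n≡0⇒m≡0∨n≡0 ∣ i ∣ eq)

∣i∣²≡1⇒i≡±1 : ∀ i → ∣ i ∣² ≡ 1 → i ≡ + 1 ⊎ i ≡ -[1+ 0 ]
∣i∣²≡1⇒i≡±1 i eq = ∣i∣≡1⇒i≡±1 i (ℕP.m*n≡1⇒m≡1 ∣ i ∣ ∣ i ∣ eq)
  where
  ∣i∣≡1⇒i≡±1 : ∀ i → ∣ i ∣ ≡ 1 → i ≡ + 1 ⊎ i ≡ -[1+ 0 ]
  ∣i∣≡1⇒i≡±1 (+ 1)    _ = inj₁ refl
  ∣i∣≡1⇒i≡±1 -[1+ 0 ] _ = inj₂ refl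
  ∣i∣≡1⇒i≡±1 (+ 0)            ()
  ∣i∣≡1⇒i≡±1 (+ ℕ.suc (ℕ.suc _)) ()
  ∣i∣≡1⇒i≡±1 -[1+ ℕ.suc _ ]   ()

m+n≡1⇒m≡1∧n≡0∨m≡0∧n≡1 : ∀ m n → m ℕ.+ n ≡ 1 → (m ≡ 1 × n ≡ 0) ⊎ (m ≡ 0 × n ≡ 1)
m+n≡1⇒m≡1∧n≡0∨m≡0∧n≡1 ℕ.zero    n eq = inj₂ (refl , eq)
m+n≡1⇒m≡1∧n≡0∨m≡0∧n≡1 (ℕ.suc m) n eq = inj₁ (cong ℕ.suc (ℕP.m+n≡0⇒m≡0 m m+n≡0) , ℕP.m+n≡0⇒n≡0 m m+n≡0)
  where m+n≡0 = ℕP.suc-injective eq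

n≤4⇒n%4≡3⇒n≡3 : ∀ {n} → n ≤ 4 → n % 4 ≡ 3 → n ≡ 3
n≤4⇒n%4≡3⇒n≡3 {0} _ ()
n≤4⇒n%4≡3⇒n≡3 {1} _ ()
n≤4⇒n%4≡3⇒n≡3 {2} _ ()
n≤4⇒n%4≡3⇒n≡3 {3} _ _ = refl
n≤4⇒n%4≡3⇒n≡3 {4} _ ()
n≤4⇒n%4≡3⇒n≡3 {ℕ.suc (ℕ.suc (ℕ.suc (ℕ.suc (ℕ.suc _))))} (s≤s (s≤s (s≤s (s≤s ())))) _

3*n≤4⇒n≤1 : ∀ {n} → 3 ℕ.* n ≤ 4 → n ≤ 1
3*n≤4⇒n≤1 {0} _ = z≤n
3*n≤4⇒n≤1 {1} _ = s≤s z≤n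
3*n≤4⇒n≤1 {ℕ.suc (ℕ.suc n)} 3n≤4 with ℕP.≤-trans (ℕP.*-monoʳ-≤ 3 (s≤s (s≤s (z≤n {n})))) 3n≤4
... | s≤s (s≤s (s≤s (s≤s ())))

-i≡i⇒i≡0 : ∀ i → - i ≡ i → i ≡ + 0
-i≡i⇒i≡0 (+ ℕ.zero)  _ = refl
-i≡i⇒i≡0 (+ ℕ.suc _) ()
-i≡i⇒i≡0 -[1+ _ ]    ()

module Arithmetic (d : ℕ) where
  open OK d hiding (_*)

  +ₒ-assoc : ∀ x y z → (x +ₒ y) +ₒ z ≡ x +ₒ (y +ₒ z)
  +ₒ-assoc (mk a b) (mk c e) (mk f g) = cong₂ mk (ℤP.+-assoc a c f) (ℤP.+-assoc b e g)

  +ₒ-comm : ∀ x y → x +ₒ y ≡ y +ₒ x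
  +ₒ-comm (mk a b) (mk c e) = cong₂ mk (ℤP.+-comm a c) (ℤP.+-comm b e)

  +ₒ-identityˡ : ∀ x → 0ₒ +ₒ x ≡ x
  +ₒ-identityˡ (mk a b) = cong₂ mk (ℤP.+-identityˡ a) (ℤP.+-identityˡ b)

  +ₒ-identityʳ : ∀ x → x +ₒ 0ₒ ≡ x
  +ₒ-identityʳ (mk a b) = cong₂ mk (ℤP.+-identityʳ a) (ℤP.+-identityʳ b)

  +ₒ-inverseˡ : ∀ x → (-ₒ x) +ₒ x ≡ 0ₒ
  +ₒ-inverseˡ (mk a b) = cong₂ mk (ℤP.+-inverseˡ a) (ℤP.+-inverseˡ b)

  +ₒ-inverseʳ : ∀ x → x +ₒ (-ₒ x) ≡ 0ₒ
  +ₒ-inverseʳ (mk a b) = cong₂ mk (ℤP.+-inverseʳ a) (ℤP.+-inverseʳ b)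

  *ₒ-assoc : ∀ x y z → (x *ₒ y) *ₒ z ≡ x *ₒ (y *ₒ z)
  *ₒ-assoc (mk a b) (mk c e) (mk f g) = cong₂ mk (re-assoc tr nm a b c e f g) (im-assoc tr nm a b c e f g)
    where
    re-assoc : ∀ t n a b c e f g →
      (a * c - n * (b * e)) * f - n * ((a * e + b * c + t * (b * e)) * g)
        ≡ a * (c * f - n * (e * g)) - n * (b * (c * g + e * f + t * (e * g)))
    re-assoc = solve-∀
    im-assoc : ∀ t n a b c e f g →
      (a * c - n * (b * e)) * g + (a * e + b * c + t * (b * e)) * f + t * ((a * e + b * c + t * (b * e)) * g)
        ≡ a * (c * g + e * f + t * (e * g)) + b * (c * f - n * (e * g)) + t * (b * (c * g + e * f + t * (e * g)))
    im-assoc = solve-∀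

  *ₒ-comm : ∀ x y → x *ₒ y ≡ y *ₒ x
  *ₒ-comm (mk a b) (mk c e) = cong₂ mk (re-comm nm a b c e) (im-comm tr a b c e)
    where
    re-comm : ∀ n a b c e → a * c - n * (b * e) ≡ c * a - n * (e * b)
    re-comm = solve-∀
    im-comm : ∀ t a b c e → a * e + b * c + t * (b * e) ≡ c * b + e * a + t * (e * b)
    im-comm = solve-∀

  *ₒ-identityˡ : ∀ x → 1ₒ *ₒ x ≡ x
  *ₒ-identityˡ (mk a b) = cong₂ mk (re-identity nm a b) (im-identity tr a b)
    where
    re-identity : ∀ n a b → + 1 * a - n * (+ 0 * b) ≡ a
    re-identity = solve-∀
    im-identity : ∀ t a b → + 1 * b + + 0 * a + t * (+ 0 * b) ≡ b
    im-identity = solve-∀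

  *ₒ-identityʳ : ∀ x → x *ₒ 1ₒ ≡ x
  *ₒ-identityʳ x = trans (*ₒ-comm x 1ₒ) (*ₒ-identityˡ x)

  *ₒ-distribˡ : ∀ x y z → x *ₒ (y +ₒ z) ≡ x *ₒ y +ₒ x *ₒ z
  *ₒ-distribˡ (mk a b) (mk c e) (mk f g) = cong₂ mk (re-distrib nm a b c e f g) (im-distrib tr a b c e f g)
    where
    re-distrib : ∀ n a b c e f g →
      a * (c + f) - n * (b * (e + g)) ≡ (a * c - n * (b * e)) + (a * f - n * (b * g))
    re-distrib = solve-∀
    im-distrib : ∀ t a b c e f g →
      a * (e + g) + b * (c + f) + t * (b * (e + g)) ≡ (a * e + b * c + t * (b * e)) + (a * g + b * f + t * (b * g))
    im-distrib = solve-∀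

  *ₒ-distribʳ : ∀ x y z → (y +ₒ z) *ₒ x ≡ y *ₒ x +ₒ z *ₒ x
  *ₒ-distribʳ x y z = begin
    (y +ₒ z) *ₒ x       ≡⟨ *ₒ-comm (y +ₒ z) x ⟩
    x *ₒ (y +ₒ z)       ≡⟨ *ₒ-distribˡ x y z ⟩
    x *ₒ y +ₒ x *ₒ z    ≡⟨ cong₂ _+ₒ_ (*ₒ-comm x y) (*ₒ-comm x z) ⟩
    y *ₒ x +ₒ z *ₒ x    ∎

  isCommutativeRing : IsCommutativeRing _≡_ _+ₒ_ _*ₒ_ -ₒ_ 0ₒ 1ₒ
  isCommutativeRing = record
    { isRing = record
      { +-isAbelianGroup = record
        { isGroup = record
          { isMonoid = record
            { isSemigroup = record
              { isMagma = record { isEquivalence = isEquivalence ; ∙-cong = cong₂ _+ₒ_ }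
              ; assoc = +ₒ-assoc }
            ; identity = +ₒ-identityˡ , +ₒ-identityʳ }
          ; inverse = +ₒ-inverseˡ , +ₒ-inverseʳ
          ; ⁻¹-cong = cong -ₒ_ }
        ; comm = +ₒ-comm }
      ; *-cong = cong₂ _*ₒ_
      ; *-assoc = *ₒ-assoc
      ; *-identity = *ₒ-identityˡ , *ₒ-identityʳ
      ; distrib = *ₒ-distribˡ , *ₒ-distribʳ }
    ; *-comm = *ₒ-comm }

  commutativeRing : CommutativeRing _ _
  commutativeRing = record { isCommutativeRing = isCommutativeRing }

  ι-* : ∀ a b → ι (a * b) ≡ ι a *ₒ ι b
  ι-* a b = sym (cong₂ mk (re-ι nm a b) (im-ι tr a b))
    where
    re-ι : ∀ n a b → a * b - n * (+ 0 * + 0) ≡ a * b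
    re-ι = solve-∀
    im-ι : ∀ t a b → a * + 0 + + 0 * b + t * (+ 0 * + 0) ≡ + 0
    im-ι = solve-∀

  ι-morphism : ACR._-Raw-AlmostCommutative⟶_ (CommutativeRing.rawRing ℤP.+-*-commutativeRing)
                                             (ACR.fromCommutativeRing commutativeRing)
  ι-morphism = record
    { ⟦_⟧ = ι
    ; +-homo = λ _ _ → refl
    ; *-homo = ι-*
    ; -‿homo = λ _ → refl
    ; 0-homo = refl
    ; 1-homo = refl }

  ι-≟ : ∀ a b → Maybe (ι a ≡ ι b)
  ι-≟ a b with a ≟ b
  ... | yes a≡b = just (cong ι a≡b)
  ... | no _    = nothing

  open import Algebra.Solver.Ring _ _ ι-morphism ι-≟ public

  conj-+ : ∀ x y → conj (x +ₒ y) ≡ conj x +ₒ conj y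
  conj-+ (mk a b) (mk c e) = cong₂ mk (re-conj-+ tr a b c e) (ℤP.neg-distrib-+ b e)
    where
    re-conj-+ : ∀ t a b c e → (a + c) + t * (b + e) ≡ (a + t * b) + (c + t * e)
    re-conj-+ = solve-∀

  conj-neg : ∀ x → conj (-ₒ x) ≡ -ₒ conj x
  conj-neg (mk a b) = cong₂ mk (re-conj-neg tr a b) refl
    where
    re-conj-neg : ∀ t a b → - a + t * - b ≡ - (a + t * b)
    re-conj-neg = solve-∀

  conj-* : ∀ x y → conj (x *ₒ y) ≡ conj x *ₒ conj y
  conj-* (mk a b) (mk c e) = cong₂ mk (re-conj-* tr nm a b c e) (im-conj-* tr nm a b c e)
    where
    re-conj-* : ∀ t n a b c e →
      (a * c - n * (b * e)) + t * (a * e + b * c + t * (b * e)) ≡ (a + t * b) * (c + t * e) - n * (- b * - e)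
    re-conj-* = solve-∀
    im-conj-* : ∀ t n a b c e →
      - (a * e + b * c + t * (b * e)) ≡ (a + t * b) * - e + - b * (c + t * e) + t * (- b * - e)
    im-conj-* = solve-∀

  conj-involutive : ∀ x → conj (conj x) ≡ x
  conj-involutive (mk a b) = cong₂ mk (re-conj-conj tr a b) (ℤP.neg-involutive b)
    where
    re-conj-conj : ∀ t a b → (a + t * b) + t * - b ≡ a
    re-conj-conj = solve-∀

  conj-ι : ∀ a → conj (ι a) ≡ ι a
  conj-ι a = cong₂ mk (re-conj-ι tr a) refl
    where
    re-conj-ι : ∀ t a → a + t * + 0 ≡ a
    re-conj-ι = solve-∀

  conj-fixed⇒ι : ∀ x → conj x ≡ x → x ≡ ι (re x)
  conj-fixed⇒ι (mk a b) conj-x≡x = cong (mk a) (-i≡i⇒i≡0 b (cong im conj-x≡x))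

  N : 𝒪 → ℤ
  N x = re (x *ₒ conj x)

  *ₒ-conj≡ι-N : ∀ x → x *ₒ conj x ≡ ι (N x)
  *ₒ-conj≡ι-N (mk a b) = cong (mk _) (im-norm tr nm a b)
    where
    im-norm : ∀ t n a b → a * - b + b * (a + t * b) + t * (b * - b) ≡ + 0
    im-norm = solve-∀

  N-* : ∀ x y → N (x *ₒ y) ≡ N x * N y
  N-* x y = cong re (begin
    ι (N (x *ₒ y))                     ≡⟨ sym (*ₒ-conj≡ι-N (x *ₒ y)) ⟩
    (x *ₒ y) *ₒ conj (x *ₒ y)          ≡⟨ cong ((x *ₒ y) *ₒ_) (conj-* x y) ⟩
    (x *ₒ y) *ₒ (conj x *ₒ conj y)     ≡⟨ solve 4 (λ x y x' y' → (x :* y) :* (x' :* y') := (x :* x') :* (y :* y'))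
                                                refl x y (conj x) (conj y) ⟩
    (x *ₒ conj x) *ₒ (y *ₒ conj y)     ≡⟨ cong₂ _*ₒ_ (*ₒ-conj≡ι-N x) (*ₒ-conj≡ι-N y) ⟩
    ι (N x) *ₒ ι (N y)                 ≡⟨ sym (ι-* (N x) (N y)) ⟩
    ι (N x * N y)                      ∎)

  N-1ₒ : N 1ₒ ≡ + 1
  N-1ₒ = cong re (trans (cong (1ₒ *ₒ_) (conj-ι (+ 1))) (*ₒ-identityˡ 1ₒ))

  N-^ : ∀ x k → N (x ^ₒ k) ≡ N x ^ k
  N-^ x ℕ.zero    = N-1ₒ
  N-^ x (ℕ.suc k) = trans (N-* x (x ^ₒ k)) (cong (N x *_) (N-^ x k))

  ι-*ₒ : ∀ s x → ι s *ₒ x ≡ mk (s * re x) (s * im x)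
  ι-*ₒ s (mk a b) = cong₂ mk (re-ι nm s a b) (im-ι tr s a b)
    where
    re-ι : ∀ n s a b → s * a - n * (+ 0 * b) ≡ s * a
    re-ι = solve-∀
    im-ι : ∀ t s a b → s * b + + 0 * a + t * (+ 0 * b) ≡ s * b
    im-ι = solve-∀

module Units (d : ℕ) where
  open OK d hiding (_*)
  open Arithmetic d

  tr≡0 : ¬ d % 4 ≡ 3 → tr ≡ + 0
  tr≡0 h with d % 4 ℕ.≟ 3
  ... | yes p = ⊥-elim (h p)
  ... | no _  = refl

  nm≡d : ¬ d % 4 ≡ 3 → nm ≡ + d
  nm≡d h with d % 4 ℕ.≟ 3
  ... | yes p = ⊥-elim (h p)
  ... | no _  = refl

  tr≡1 : d % 4 ≡ 3 → tr ≡ + 1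
  tr≡1 h with d % 4 ℕ.≟ 3
  ... | yes _ = refl
  ... | no ¬h = ⊥-elim (¬h h)

  d≡3+4[d/4] : d % 4 ≡ 3 → d ≡ 3 ℕ.+ 4 ℕ.* (d / 4)
  d≡3+4[d/4] h = begin
    d                          ≡⟨ m≡m%n+[m/n]*n d 4 ⟩
    d % 4 ℕ.+ (d / 4) ℕ.* 4    ≡⟨ cong₂ ℕ._+_ h (ℕP.*-comm (d / 4) 4) ⟩
    3 ℕ.+ 4 ℕ.* (d / 4)        ∎

  nm≡1+[d/4] : d % 4 ≡ 3 → nm ≡ + 1 + + (d / 4)
  nm≡1+[d/4] h with d % 4 ℕ.≟ 3
  ... | no ¬h = ⊥-elim (¬h h)
  ... | yes _ = cong +_ (begin
    (d ℕ.+ 1) / 4                      ≡⟨ cong (λ n → (n ℕ.+ 1) / 4) (d≡3+4[d/4] h) ⟩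
    (3 ℕ.+ 4 ℕ.* (d / 4) ℕ.+ 1) / 4    ≡⟨ cong (_/ 4) (ℕP.+-comm (3 ℕ.+ 4 ℕ.* (d / 4)) 1) ⟩
    (4 ℕ.+ 4 ℕ.* (d / 4)) / 4          ≡⟨ cong (λ n → (4 ℕ.+ n) / 4) (ℕP.*-comm 4 (d / 4)) ⟩
    ℕ.suc (d / 4) ℕ.* 4 / 4            ≡⟨ m*n/n≡m (ℕ.suc (d / 4)) 4 ⟩
    ℕ.suc (d / 4)                      ∎)

  +d≡3+4[d/4] : d % 4 ≡ 3 → + d ≡ + 3 + + 4 * + (d / 4)
  +d≡3+4[d/4] h = trans (cong +_ (d≡3+4[d/4] h)) (trans (ℤP.pos-+ 3 (4 ℕ.* (d / 4))) (cong (_+_ (+ 3)) (ℤP.pos-* 4 (d / 4))))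

  d≡3⇒nm≡1 : d % 4 ≡ 3 → d ≡ 3 → nm ≡ + 1
  d≡3⇒nm≡1 h d≡3 = trans (nm≡1+[d/4] h) (cong (λ n → + 1 + + (n / 4)) d≡3)

  N-mk : ∀ p q → N (mk p q) ≡ p * p + tr * (p * q) + nm * (q * q)
  N-mk p q = expand tr nm p q
    where
    expand : ∀ t n p q → p * (p + t * q) - n * (q * - q) ≡ p * p + t * (p * q) + n * (q * q)
    expand = solve-∀

  N-ι : ∀ p → N (ι p) ≡ p * p
  N-ι p = trans (N-mk p (+ 0)) (simplify tr nm p)
    where
    simplify : ∀ t n p → p * p + t * (p * + 0) + n * (+ 0 * + 0) ≡ p * p
    simplify = solve-∀

  N-when-tr≡0 : ¬ d % 4 ≡ 3 → ∀ p q → N (mk p q) ≡ + (∣ p ∣² ℕ.+ d ℕ.* ∣ q ∣²)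
  N-when-tr≡0 h p q = begin
    N (mk p q)                               ≡⟨ N-mk p q ⟩
    p * p + tr * (p * q) + nm * (q * q)      ≡⟨ cong₂ (λ t n → p * p + t * (p * q) + n * (q * q)) (tr≡0 h) (nm≡d h) ⟩
    p * p + + 0 * (p * q) + + d * (q * q)    ≡⟨ simplify p q (+ d) ⟩
    p * p + + d * (q * q)                    ≡⟨ cong₂ (λ x y → x + + d * y) (i*i≡+∣i∣² p) (i*i≡+∣i∣² q) ⟩
    + ∣ p ∣² + + d * + ∣ q ∣²                ≡⟨ cong (_+_ (+ ∣ p ∣²)) (sym (ℤP.pos-* d ∣ q ∣²)) ⟩
    + ∣ p ∣² + + (d ℕ.* ∣ q ∣²)              ≡⟨ sym (ℤP.pos-+ ∣ p ∣² (d ℕ.* ∣ q ∣²)) ⟩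
    + (∣ p ∣² ℕ.+ d ℕ.* ∣ q ∣²)              ∎
    where
    simplify : ∀ p q e → p * p + + 0 * (p * q) + e * (q * q) ≡ p * p + e * (q * q)
    simplify = solve-∀

  -- Completing the square: 4 (p² + pq + (1 + j) q²) = (2p + q)² + (3 + 4j) q².
  4N-when-tr≡1 : d % 4 ≡ 3 → ∀ p q → + 4 * N (mk p q) ≡ + (∣ + 2 * p + q ∣² ℕ.+ d ℕ.* ∣ q ∣²)
  4N-when-tr≡1 h p q = begin
    + 4 * N (mk p q)                                               ≡⟨ cong ((+ 4) *_) (N-mk p q) ⟩
    + 4 * (p * p + tr * (p * q) + nm * (q * q))                    ≡⟨ cong₂ (λ t n → + 4 * (p * p + t * (p * q) + n * (q * q)))
                                                                              (tr≡1 h) (nm≡1+[d/4] h) ⟩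
    + 4 * (p * p + + 1 * (p * q) + (+ 1 + + j) * (q * q))          ≡⟨ complete-square p q (+ j) ⟩
    (+ 2 * p + q) * (+ 2 * p + q) + (+ 3 + + 4 * + j) * (q * q)    ≡⟨ cong₂ (λ x y → x + y * (q * q))
                                                                              (i*i≡+∣i∣² (+ 2 * p + q)) (sym (+d≡3+4[d/4] h)) ⟩
    + ∣ + 2 * p + q ∣² + + d * (q * q)                             ≡⟨ cong (λ y → + ∣ + 2 * p + q ∣² + + d * y) (i*i≡+∣i∣² q) ⟩
    + ∣ + 2 * p + q ∣² + + d * + ∣ q ∣²                            ≡⟨ cong (_+_ (+ ∣ + 2 * p + q ∣²)) (sym (ℤP.pos-* d ∣ q ∣²)) ⟩
    + ∣ + 2 * p + q ∣² + + (d ℕ.* ∣ q ∣²)                          ≡⟨ sym (ℤP.pos-+ ∣ + 2 * p + q ∣² (d ℕ.* ∣ q ∣²)) ⟩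
    + (∣ + 2 * p + q ∣² ℕ.+ d ℕ.* ∣ q ∣²)                          ∎
    where
    j = d / 4
    complete-square : ∀ p q j →
      + 4 * (p * p + + 1 * (p * q) + (+ 1 + j) * (q * q)) ≡ (+ 2 * p + q) * (+ 2 * p + q) + (+ 3 + + 4 * j) * (q * q)
    complete-square = solve-∀

  N-nonneg : ∀ x → Σ ℕ λ m → N x ≡ + m
  N-nonneg (mk p q) = by-cases (d % 4 ℕ.≟ 3)
    where
    nonneg : ∀ i {m} → + 4 * i ≡ + m → Σ ℕ λ k → i ≡ + k
    nonneg (+ k) _ = k , refl
    by-cases : Dec (d % 4 ≡ 3) → Σ ℕ λ m → N (mk p q) ≡ + m
    by-cases (no h)  = _ , N-when-tr≡0 h p q
    by-cases (yes h) = nonneg (N (mk p q)) (4N-when-tr≡1 h p q)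

  +-^ : ∀ m k → (+ m) ^ k ≡ + (m ℕ.^ k)
  +-^ m ℕ.zero    = refl
  +-^ m (ℕ.suc k) = trans (cong ((+ m) *_) (+-^ m k)) (sym (ℤP.pos-* m (m ℕ.^ k)))

  root-of-unity⇒unitary : ∀ ζ → RootOfUnity ζ → conj ζ *ₒ ζ ≡ 1ₒ
  root-of-unity⇒unitary ζ (n , 1≤n , ζⁿ≡1) with N-nonneg ζ
  ... | m , Nζ≡m with ℕP.m^n≡1⇒n≡0∨m≡1 m n (ℤP.+-injective mⁿ≡1)
    where
    mⁿ≡1 : + (m ℕ.^ n) ≡ + 1
    mⁿ≡1 = begin
      + (m ℕ.^ n)   ≡⟨ sym (+-^ m n) ⟩
      (+ m) ^ n     ≡⟨ cong (_^ n) (sym Nζ≡m) ⟩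
      N ζ ^ n       ≡⟨ sym (N-^ ζ n) ⟩
      N (ζ ^ₒ n)    ≡⟨ cong N ζⁿ≡1 ⟩
      N 1ₒ          ≡⟨ N-1ₒ ⟩
      + 1           ∎
  ... | inj₁ refl = ⊥-elim (ℕP.<⇒≢ 1≤n refl)
  ... | inj₂ refl = begin
    conj ζ *ₒ ζ   ≡⟨ *ₒ-comm (conj ζ) ζ ⟩
    ζ *ₒ conj ζ   ≡⟨ *ₒ-conj≡ι-N ζ ⟩
    ι (N ζ)       ≡⟨ cong ι Nζ≡m ⟩
    1ₒ            ∎

  -1ₒ : 𝒪
  -1ₒ = mk -[1+ 0 ] (+ 0)

  integral-unit⇒±1 : ∀ p → N (ι p) ≡ + 1 → ι p ≡ 1ₒ ⊎ ι p ≡ -1ₒ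
  integral-unit⇒±1 p N≡1 = Sum.map (cong ι) (cong ι) (∣i∣²≡1⇒i≡±1 p ∣p∣²≡1)
    where
    ∣p∣²≡1 : ∣ p ∣² ≡ 1
    ∣p∣²≡1 = ℤP.+-injective (trans (sym (i*i≡+∣i∣² p)) (trans (sym (N-ι p)) N≡1))

  nonintegral-unit-when-tr≡0 : 1 ≤ d → ¬ d % 4 ≡ 3 → ∀ p q → 1 ≤ ∣ q ∣² → N (mk p q) ≡ + 1 →
    d ≡ 1 × (mk p q ≡ mk (+ 0) (+ 1) ⊎ mk p q ≡ mk (+ 0) -[1+ 0 ])
  nonintegral-unit-when-tr≡0 1≤d h p q 1≤∣q∣² N≡1
    with m+n≡1⇒m≡1∧n≡0∨m≡0∧n≡1 ∣ p ∣² (d ℕ.* ∣ q ∣²) (ℤP.+-injective (trans (sym (N-when-tr≡0 h p q)) N≡1))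
  ... | inj₁ (_ , d∣q∣²≡0) = ⊥-elim (ℕP.<⇒≢ (ℕP.*-mono-≤ 1≤d 1≤∣q∣²) (sym d∣q∣²≡0))
  ... | inj₂ (∣p∣²≡0 , d∣q∣²≡1) =
    ℕP.m*n≡1⇒m≡1 d ∣ q ∣² d∣q∣²≡1 ,
    Sum.map (cong₂ mk p≡0) (cong₂ mk p≡0) (∣i∣²≡1⇒i≡±1 q (ℕP.m*n≡1⇒n≡1 d ∣ q ∣² d∣q∣²≡1))
    where
    p≡0 = ∣i∣²≡0⇒i≡0 p ∣p∣²≡0

  units-when-tr≡0 : 1 ≤ d → ¬ d % 4 ≡ 3 → ∀ u → N u ≡ + 1 →
    u ≡ 1ₒ ⊎ u ≡ -1ₒ ⊎ (d ≡ 1 × (u ≡ mk (+ 0) (+ 1) ⊎ u ≡ mk (+ 0) -[1+ 0 ]))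
  units-when-tr≡0 1≤d h (mk p (+ 0)) N≡1 = Sum.map₂ inj₁ (integral-unit⇒±1 p N≡1)
  units-when-tr≡0 1≤d h (mk p q@(+ ℕ.suc _)) N≡1 = inj₂ (inj₂ (nonintegral-unit-when-tr≡0 1≤d h p q (s≤s z≤n) N≡1))
  units-when-tr≡0 1≤d h (mk p q@(-[1+ _ ])) N≡1 = inj₂ (inj₂ (nonintegral-unit-when-tr≡0 1≤d h p q (s≤s z≤n) N≡1))

  -- For d = 3 these are ω, ω² = ω - 1, ω⁴ = -ω and ω⁵ = 1 - ω.
  NonrealSixthRoot : 𝒪 → Set
  NonrealSixthRoot u =
    u ≡ mk (+ 0) (+ 1) ⊎ u ≡ mk -[1+ 0 ] (+ 1) ⊎ u ≡ mk (+ 0) -[1+ 0 ] ⊎ u ≡ mk (+ 1) -[1+ 0 ]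

  nonintegral-unit-when-tr≡1 : d % 4 ≡ 3 → ∀ p q → 1 ≤ ∣ q ∣² → N (mk p q) ≡ + 1 →
    d ≡ 3 × NonrealSixthRoot (mk p q)
  nonintegral-unit-when-tr≡1 h p q 1≤∣q∣² N≡1 = d≡3 , units (∣i∣²≡1⇒i≡±1 q ∣q∣²≡1) p≡0∨p≡-q
    where
    4N≡4 : ∣ + 2 * p + q ∣² ℕ.+ d ℕ.* ∣ q ∣² ≡ 4
    4N≡4 = ℤP.+-injective (trans (sym (4N-when-tr≡1 h p q)) (cong (_*_ (+ 4)) N≡1))
    d∣q∣²≤4 : d ℕ.* ∣ q ∣² ≤ 4
    d∣q∣²≤4 = subst (d ℕ.* ∣ q ∣² ≤_) 4N≡4 (ℕP.m≤n+m (d ℕ.* ∣ q ∣²) ∣ + 2 * p + q ∣²)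
    d≤d∣q∣² : d ≤ d ℕ.* ∣ q ∣²
    d≤d∣q∣² = subst (_≤ d ℕ.* ∣ q ∣²) (ℕP.*-identityʳ d) (ℕP.*-monoʳ-≤ d 1≤∣q∣²)
    d≡3 : d ≡ 3
    d≡3 = n≤4⇒n%4≡3⇒n≡3 (ℕP.≤-trans d≤d∣q∣² d∣q∣²≤4) h
    ∣q∣²≡1 : ∣ q ∣² ≡ 1
    ∣q∣²≡1 = ℕP.≤-antisym (3*n≤4⇒n≤1 (subst (λ n → n ℕ.* ∣ q ∣² ≤ 4) d≡3 d∣q∣²≤4)) 1≤∣q∣²
    N≡1′ : p * p + + 1 * (p * q) + + 1 * (q * q) ≡ + 1
    N≡1′ = begin
      p * p + + 1 * (p * q) + + 1 * (q * q)   ≡⟨ cong₂ (λ t n → p * p + t * (p * q) + n * (q * q)) (tr≡1 h)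
                                                     (d≡3⇒nm≡1 h d≡3) ⟨
      p * p + tr * (p * q) + nm * (q * q)     ≡⟨ N-mk p q ⟨
      N (mk p q)                              ≡⟨ N≡1 ⟩
      + 1                                     ∎
    p[p+q]≡0 : p * (p + q) ≡ + 0
    p[p+q]≡0 = begin
      p * (p + q)                                         ≡⟨ rearrange p q ⟩
      (p * p + + 1 * (p * q) + + 1 * (q * q)) - q * q     ≡⟨ cong₂ _-_ N≡1′ (trans (i*i≡+∣i∣² q) (cong +_ ∣q∣²≡1)) ⟩
      + 0                                                 ∎
      where
      rearrange : ∀ p q → p * (p + q) ≡ (p * p + + 1 * (p * q) + + 1 * (q * q)) - q * q
      rearrange = solve-∀
    p≡0∨p≡-q : p ≡ + 0 ⊎ p ≡ - q
    p≡0∨p≡-q = Sum.map₂ (λ p+q≡0 → ℤP.i-j≡0⇒i≡j p (- q) (trans (cong (_+_ p) (ℤP.neg-involutive q)) p+q≡0))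
                        (ℤP.i*j≡0⇒i≡0∨j≡0 p p[p+q]≡0)
    units : ∀ {p q} → q ≡ + 1 ⊎ q ≡ -[1+ 0 ] → p ≡ + 0 ⊎ p ≡ - q → NonrealSixthRoot (mk p q)
    units (inj₁ refl) (inj₁ refl) = inj₁ refl
    units (inj₁ refl) (inj₂ refl) = inj₂ (inj₁ refl)
    units (inj₂ refl) (inj₁ refl) = inj₂ (inj₂ (inj₁ refl))
    units (inj₂ refl) (inj₂ refl) = inj₂ (inj₂ (inj₂ refl))

  units-when-tr≡1 : d % 4 ≡ 3 → ∀ u → N u ≡ + 1 → u ≡ 1ₒ ⊎ u ≡ -1ₒ ⊎ (d ≡ 3 × NonrealSixthRoot u)
  units-when-tr≡1 h (mk p (+ 0)) N≡1 = Sum.map₂ inj₁ (integral-unit⇒±1 p N≡1)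
  units-when-tr≡1 h (mk p q@(+ ℕ.suc _)) N≡1 = inj₂ (inj₂ (nonintegral-unit-when-tr≡1 h p q (s≤s z≤n) N≡1))
  units-when-tr≡1 h (mk p q@(-[1+ _ ])) N≡1 = inj₂ (inj₂ (nonintegral-unit-when-tr≡1 h p q (s≤s z≤n) N≡1))

module Unitary (d : ℕ) where
  open OK d hiding (_*)
  open OK d using () renaming (_* to _ᴴ)
  open Arithmetic d

  mat-cong : ∀ {a b c e a′ b′ c′ e′} → a ≡ a′ → b ≡ b′ → c ≡ c′ → e ≡ e′ → mat a b c e ≡ mat a′ b′ c′ e′
  mat-cong refl refl refl refl = refl

  ·J : ∀ a b c e → mat a b c e · J ≡ mat b (-ₒ a) e (-ₒ c)
  ·J a b c e = mat-cong (right-col a b) (left-col a b) (right-col c e) (left-col c e)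
    where
    right-col : ∀ x y → x *ₒ 0ₒ +ₒ y *ₒ 1ₒ ≡ y
    right-col = solve 2 (λ x y → x :* con (+ 0) :+ y :* con (+ 1) := y) refl
    left-col : ∀ x y → x *ₒ (-ₒ 1ₒ) +ₒ y *ₒ 0ₒ ≡ -ₒ x
    left-col = solve 2 (λ x y → x :* (:- con (+ 1)) :+ y :* con (+ 0) := :- x) refl

  det-scal : ∀ z A → det (scal z A) ≡ (z *ₒ z) *ₒ det A
  det-scal z (mat a b c e) =
    solve 5 (λ z a b c e → (z :* a) :* (z :* e) :+ :- ((z :* b) :* (z :* c)) := (z :* z) :* (a :* e :+ :- (b :* c)))
      refl z a b c e

  det-invertible⇒GL₂ : ∀ A v → det A *ₒ v ≡ 1ₒ → GL₂ A
  det-invertible⇒GL₂ (mat a b c e) v det·v≡1 =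
    scal v (mat e (-ₒ b) (-ₒ c) a) ,
    mat-cong (trans (solve 5 (λ a b c e v → a :* (v :* e) :+ b :* (v :* (:- c)) := (a :* e :+ :- (b :* c)) :* v) refl a b c e v) det·v≡1)
             (solve 3 (λ a b v → a :* (v :* (:- b)) :+ b :* (v :* a) := con (+ 0)) refl a b v)
             (solve 3 (λ c e v → c :* (v :* e) :+ e :* (v :* (:- c)) := con (+ 0)) refl c e v)
             (trans (solve 5 (λ a b c e v → c :* (v :* (:- b)) :+ e :* (v :* a) := (a :* e :+ :- (b :* c)) :* v) refl a b c e v) det·v≡1) ,
    mat-cong (trans (solve 5 (λ a b c e v → (v :* e) :* a :+ (v :* (:- b)) :* c := (a :* e :+ :- (b :* c)) :* v) refl a b c e v) det·v≡1)
             (solve 3 (λ b e v → (v :* e) :* b :+ (v :* (:- b)) :* e := con (+ 0)) refl b e v)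
             (solve 3 (λ a c v → (v :* (:- c)) :* a :+ (v :* a) :* c := con (+ 0)) refl a c v)
             (trans (solve 5 (λ a b c e v → (v :* (:- c)) :* b :+ (v :* a) :* e := (a :* e :+ :- (b :* c)) :* v) refl a b c e v) det·v≡1)

  scal-integral-preserves-J : ∀ ζ a b c e → conj ζ *ₒ ζ ≡ 1ₒ → det (mat (ι a) (ι b) (ι c) (ι e)) ≡ 1ₒ →
    let A = scal ζ (mat (ι a) (ι b) (ι c) (ι e)) in (A · J) · (A ᴴ) ≡ J
  scal-integral-preserves-J ζ a b c e ζ̄ζ≡1 det≡1 =
    trans (cong₂ _·_ (·J (ζ *ₒ ι a) (ζ *ₒ ι b) (ζ *ₒ ι c) (ζ *ₒ ι e)) ζBᴴ) (mat-cong e₁₁ e₁₂ e₂₁ e₂₂)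
    where
    ζ̄ = conj ζ
    D = det (mat (ι a) (ι b) (ι c) (ι e))
    conj-ζι : ∀ x → conj (ζ *ₒ ι x) ≡ ζ̄ *ₒ ι x
    conj-ζι x = trans (conj-* ζ (ι x)) (cong (ζ̄ *ₒ_) (conj-ι x))
    ζBᴴ : scal ζ (mat (ι a) (ι b) (ι c) (ι e)) ᴴ ≡ mat (ζ̄ *ₒ ι a) (ζ̄ *ₒ ι c) (ζ̄ *ₒ ι b) (ζ̄ *ₒ ι e)
    ζBᴴ = mat-cong (conj-ζι a) (conj-ζι c) (conj-ζι b) (conj-ζι e)
    e₁₁ = solve 4 (λ z z̄ a b → (z :* b) :* (z̄ :* a) :+ (:- (z :* a)) :* (z̄ :* b) := con (+ 0)) refl ζ ζ̄ (ι a) (ι b)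
    e₂₂ = solve 4 (λ z z̄ c e → (z :* e) :* (z̄ :* c) :+ (:- (z :* c)) :* (z̄ :* e) := con (+ 0)) refl ζ ζ̄ (ι c) (ι e)
    e₁₂ = begin
      (ζ *ₒ ι b) *ₒ (ζ̄ *ₒ ι c) +ₒ (-ₒ (ζ *ₒ ι a)) *ₒ (ζ̄ *ₒ ι e)
        ≡⟨ solve 6 (λ z z̄ a b c e → (z :* b) :* (z̄ :* c) :+ (:- (z :* a)) :* (z̄ :* e) := :- ((z̄ :* z) :* (a :* e :+ :- (b :* c))))
             refl ζ ζ̄ (ι a) (ι b) (ι c) (ι e) ⟩
      -ₒ ((ζ̄ *ₒ ζ) *ₒ D)      ≡⟨ cong₂ (λ w v → -ₒ (w *ₒ v)) ζ̄ζ≡1 det≡1 ⟩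
      -ₒ (1ₒ *ₒ 1ₒ)           ≡⟨ cong -ₒ_ (*ₒ-identityˡ 1ₒ) ⟩
      -ₒ 1ₒ                   ∎
    e₂₁ = begin
      (ζ *ₒ ι e) *ₒ (ζ̄ *ₒ ι a) +ₒ (-ₒ (ζ *ₒ ι c)) *ₒ (ζ̄ *ₒ ι b)
        ≡⟨ solve 6 (λ z z̄ a b c e → (z :* e) :* (z̄ :* a) :+ (:- (z :* c)) :* (z̄ :* b) := (z̄ :* z) :* (a :* e :+ :- (b :* c)))
             refl ζ ζ̄ (ι a) (ι b) (ι c) (ι e) ⟩
      (ζ̄ *ₒ ζ) *ₒ D           ≡⟨ cong₂ _*ₒ_ ζ̄ζ≡1 det≡1 ⟩
      1ₒ *ₒ 1ₒ                ≡⟨ *ₒ-identityˡ 1ₒ ⟩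
      1ₒ                      ∎

  scal-SL₂ℤ-unitary : ∀ ζ B → conj ζ *ₒ ζ ≡ 1ₒ → SL₂ℤ B → U11 (scal ζ B)
  scal-SL₂ℤ-unitary ζ B@.(mat (ι a) (ι b) (ι c) (ι e)) ζ̄ζ≡1 ((a , b , c , e , refl) , det≡1) =
    det-invertible⇒GL₂ (scal ζ B) (ζ̄ *ₒ ζ̄) det·ζ̄²≡1 , scal-integral-preserves-J ζ a b c e ζ̄ζ≡1 det≡1
    where
    ζ̄ = conj ζ
    det·ζ̄²≡1 : det (scal ζ B) *ₒ (ζ̄ *ₒ ζ̄) ≡ 1ₒ
    det·ζ̄²≡1 = begin
      det (scal ζ B) *ₒ (ζ̄ *ₒ ζ̄)           ≡⟨ cong (_*ₒ (ζ̄ *ₒ ζ̄)) (det-scal ζ B) ⟩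
      ((ζ *ₒ ζ) *ₒ det B) *ₒ (ζ̄ *ₒ ζ̄)      ≡⟨ solve 3 (λ z z̄ D → ((z :* z) :* D) :* (z̄ :* z̄) := ((z̄ :* z) :* (z̄ :* z)) :* D) refl ζ ζ̄ (det B) ⟩
      ((ζ̄ *ₒ ζ) *ₒ (ζ̄ *ₒ ζ)) *ₒ det B      ≡⟨ cong₂ (λ w v → (w *ₒ w) *ₒ v) ζ̄ζ≡1 det≡1 ⟩
      (1ₒ *ₒ 1ₒ) *ₒ 1ₒ                     ≡⟨ solve 0 (con (+ 1) :* con (+ 1) :* con (+ 1) := con (+ 1)) refl ⟩
      1ₒ                                   ∎

  Twisted : 𝒪 → 𝒪 → Set
  Twisted u x = x ≡ u *ₒ conj x

  record UnitaryEntries (A : Mat) : Set where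
    field
      twisted₁₁ : Twisted (det A) (m11 A)
      twisted₁₂ : Twisted (det A) (m12 A)
      twisted₂₁ : Twisted (det A) (m21 A)
      twisted₂₂ : Twisted (det A) (m22 A)
      det-unitary : det A *ₒ conj (det A) ≡ 1ₒ

  twisted-via : ∀ {x} u x̄ y {L Z} → L ≡ 1ₒ → Z ≡ 0ₒ → x *ₒ L ≡ u *ₒ x̄ +ₒ y *ₒ Z → x ≡ u *ₒ x̄
  twisted-via {x} u x̄ y {L} {Z} L≡1 Z≡0 xL≡ux̄+yZ = begin
    x                     ≡⟨ *ₒ-identityʳ x ⟨
    x *ₒ 1ₒ               ≡⟨ cong (x *ₒ_) L≡1 ⟨
    x *ₒ L                ≡⟨ xL≡ux̄+yZ ⟩
    u *ₒ x̄ +ₒ y *ₒ Z      ≡⟨ cong (λ z → u *ₒ x̄ +ₒ y *ₒ z) Z≡0 ⟩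
    u *ₒ x̄ +ₒ y *ₒ 0ₒ     ≡⟨ solve 2 (λ ux y → ux :+ y :* con (+ 0) := ux) refl (u *ₒ x̄) y ⟩
    u *ₒ x̄                ∎

  conj-det : ∀ a b c e → conj (det (mat a b c e)) ≡ det (mat (conj a) (conj b) (conj c) (conj e))
  conj-det a b c e = begin
    conj (a *ₒ e +ₒ -ₒ (b *ₒ c))              ≡⟨ conj-+ (a *ₒ e) (-ₒ (b *ₒ c)) ⟩
    conj (a *ₒ e) +ₒ conj (-ₒ (b *ₒ c))       ≡⟨ cong₂ _+ₒ_ (conj-* a e) (trans (conj-neg (b *ₒ c)) (cong -ₒ_ (conj-* b c))) ⟩
    conj a *ₒ conj e +ₒ -ₒ (conj b *ₒ conj c) ∎

  -- For 2 × 2 matrices J N J⁻¹ = det N · (N⁻¹)ᵀ, so A J Aᴴ = J says A = J (Aᴴ)⁻¹ J⁻¹ = conj A / conj (det A).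
  unitary⇒entries : ∀ A → (A · J) · (A ᴴ) ≡ J → UnitaryEntries A
  unitary⇒entries (mat a b c e) AJAᴴ≡J = record
    { twisted₁₁ = twisted-a
    ; twisted₁₂ = twisted-b
    ; twisted₂₁ = twisted-via u c̄ (-ₒ a) (cong -ₒ_ E₁₂) E₂₂
        (solve 6 (λ a b c e c̄ ē → c :* (:- (b :* c̄ :+ (:- a) :* ē)) := (a :* e :+ :- (b :* c)) :* c̄ :+ (:- a) :* (e :* c̄ :+ (:- c) :* ē))
           refl a b c e c̄ ē)
    ; twisted₂₂ = twisted-via u ē (-ₒ b) (cong -ₒ_ E₁₂) E₂₂
        (solve 6 (λ a b c e c̄ ē → e :* (:- (b :* c̄ :+ (:- a) :* ē)) := (a :* e :+ :- (b :* c)) :* ē :+ (:- b) :* (e :* c̄ :+ (:- c) :* ē))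
           refl a b c e c̄ ē)
    ; det-unitary = u·ū≡1 }
    where
    ā = conj a
    b̄ = conj b
    c̄ = conj c
    ē = conj e
    u = det (mat a b c e)
    K : mat b (-ₒ a) e (-ₒ c) · mat ā c̄ b̄ ē ≡ J
    K = trans (cong (_· (mat a b c e ᴴ)) (sym (·J a b c e))) AJAᴴ≡J
    E₁₁ : b *ₒ ā +ₒ (-ₒ a) *ₒ b̄ ≡ 0ₒ
    E₁₁ = cong m11 K
    E₁₂ : b *ₒ c̄ +ₒ (-ₒ a) *ₒ ē ≡ -ₒ 1ₒ
    E₁₂ = cong m12 K
    E₂₁ : e *ₒ ā +ₒ (-ₒ c) *ₒ b̄ ≡ 1ₒ
    E₂₁ = cong m21 K
    E₂₂ : e *ₒ c̄ +ₒ (-ₒ c) *ₒ ē ≡ 0ₒ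
    E₂₂ = cong m22 K
    twisted-a : a ≡ u *ₒ ā
    twisted-a = twisted-via u ā c E₂₁ E₁₁
      (solve 6 (λ a b c e ā b̄ → a :* (e :* ā :+ (:- c) :* b̄) := (a :* e :+ :- (b :* c)) :* ā :+ c :* (b :* ā :+ (:- a) :* b̄))
         refl a b c e ā b̄)
    twisted-b : b ≡ u *ₒ b̄
    twisted-b = twisted-via u b̄ e E₂₁ E₁₁
      (solve 6 (λ a b c e ā b̄ → b :* (e :* ā :+ (:- c) :* b̄) := (a :* e :+ :- (b :* c)) :* b̄ :+ e :* (b :* ā :+ (:- a) :* b̄))
         refl a b c e ā b̄)
    u·ū≡1 : u *ₒ conj u ≡ 1ₒ
    u·ū≡1 = begin
      u *ₒ conj u                                ≡⟨ cong (u *ₒ_) (conj-det a b c e) ⟩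
      u *ₒ (ā *ₒ ē +ₒ -ₒ (b̄ *ₒ c̄))               ≡⟨ solve 5 (λ u ā b̄ c̄ ē → u :* (ā :* ē :+ :- (b̄ :* c̄)) := :- ((u :* b̄) :* c̄ :+ (:- (u :* ā)) :* ē))
                                                      refl u ā b̄ c̄ ē ⟩
      -ₒ ((u *ₒ b̄) *ₒ c̄ +ₒ (-ₒ (u *ₒ ā)) *ₒ ē)    ≡⟨ cong₂ (λ x y → -ₒ (y *ₒ c̄ +ₒ (-ₒ x) *ₒ ē)) twisted-a twisted-b ⟨
      -ₒ (b *ₒ c̄ +ₒ (-ₒ a) *ₒ ē)                 ≡⟨ cong -ₒ_ E₁₂ ⟩
      1ₒ                                         ∎

  twisted⇒ζ̄·integral : ∀ ζ {u x} → conj ζ *ₒ ζ ≡ 1ₒ → ζ *ₒ ζ ≡ u → Twisted u x →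
    conj ζ *ₒ x ≡ ι (re (conj ζ *ₒ x))
  twisted⇒ζ̄·integral ζ {u} {x} ζ̄ζ≡1 ζ²≡u x≡ux̄ = conj-fixed⇒ι (ζ̄ *ₒ x) (begin
    conj (ζ̄ *ₒ x)                 ≡⟨ conj-* ζ̄ x ⟩
    conj ζ̄ *ₒ conj x              ≡⟨ cong (_*ₒ conj x) (conj-involutive ζ) ⟩
    ζ *ₒ conj x                   ≡⟨ *ₒ-identityˡ _ ⟨
    1ₒ *ₒ (ζ *ₒ conj x)           ≡⟨ cong (_*ₒ (ζ *ₒ conj x)) ζ̄ζ≡1 ⟨
    (ζ̄ *ₒ ζ) *ₒ (ζ *ₒ conj x)     ≡⟨ solve 3 (λ z̄ z x̄ → (z̄ :* z) :* (z :* x̄) := z̄ :* ((z :* z) :* x̄)) refl ζ̄ ζ (conj x) ⟩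
    ζ̄ *ₒ ((ζ *ₒ ζ) *ₒ conj x)     ≡⟨ cong (λ w → ζ̄ *ₒ (w *ₒ conj x)) ζ²≡u ⟩
    ζ̄ *ₒ (u *ₒ conj x)            ≡⟨ cong (ζ̄ *ₒ_) x≡ux̄ ⟨
    ζ̄ *ₒ x                        ∎)
    where ζ̄ = conj ζ

  scalar-decomposition : ∀ A → UnitaryEntries A → ∀ ζ → conj ζ *ₒ ζ ≡ 1ₒ → ζ *ₒ ζ ≡ det A →
    Σ Mat λ B → SL₂ℤ B × A ≡ scal ζ B
  scalar-decomposition A@(mat a b c e) U ζ ζ̄ζ≡1 ζ²≡u =
    B , ((_ , _ , _ , _ , refl) , det-B≡1) ,
    mat-cong (descale twisted₁₁) (descale twisted₁₂) (descale twisted₂₁) (descale twisted₂₂)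
    where
    open UnitaryEntries U
    ζ̄ = conj ζ
    ⌊_⌋ : 𝒪 → 𝒪
    ⌊ x ⌋ = ι (re (ζ̄ *ₒ x))
    B = mat ⌊ a ⌋ ⌊ b ⌋ ⌊ c ⌋ ⌊ e ⌋
    integral : ∀ {x} → Twisted (det A) x → ζ̄ *ₒ x ≡ ⌊ x ⌋
    integral = twisted⇒ζ̄·integral ζ ζ̄ζ≡1 ζ²≡u
    descale : ∀ {x} → Twisted (det A) x → x ≡ ζ *ₒ ⌊ x ⌋
    descale {x} x≡ux̄ = sym (begin
      ζ *ₒ ⌊ x ⌋         ≡⟨ cong (ζ *ₒ_) (integral x≡ux̄) ⟨
      ζ *ₒ (ζ̄ *ₒ x)      ≡⟨ solve 3 (λ z z̄ x → z :* (z̄ :* x) := (z̄ :* z) :* x) refl ζ ζ̄ x ⟩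
      (ζ̄ *ₒ ζ) *ₒ x      ≡⟨ cong (_*ₒ x) ζ̄ζ≡1 ⟩
      1ₒ *ₒ x            ≡⟨ *ₒ-identityˡ x ⟩
      x                  ∎)
    det-B≡1 : det B ≡ 1ₒ
    det-B≡1 = begin
      det B                          ≡⟨ cong det (mat-cong (integral twisted₁₁) (integral twisted₁₂) (integral twisted₂₁) (integral twisted₂₂)) ⟨
      det (scal ζ̄ A)                 ≡⟨ det-scal ζ̄ A ⟩
      (ζ̄ *ₒ ζ̄) *ₒ det A              ≡⟨ cong ((ζ̄ *ₒ ζ̄) *ₒ_) ζ²≡u ⟨
      (ζ̄ *ₒ ζ̄) *ₒ (ζ *ₒ ζ)           ≡⟨ solve 2 (λ z̄ z → (z̄ :* z̄) :* (z :* z) := (z̄ :* z) :* (z̄ :* z)) refl ζ̄ ζ ⟩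
      (ζ̄ *ₒ ζ) *ₒ (ζ̄ *ₒ ζ)           ≡⟨ cong₂ _*ₒ_ ζ̄ζ≡1 ζ̄ζ≡1 ⟩
      1ₒ *ₒ 1ₒ                       ≡⟨ *ₒ-identityˡ 1ₒ ⟩
      1ₒ                             ∎

  -- All entries lie in ℤρ, so det A ∈ ℤρ² = ℤ m det A, forcing m to be a unit of ℤ.
  twisted⊆ℤρ⇒∣m∣≡1 : ∀ A → UnitaryEntries A → ∀ ρ m → ρ *ₒ ρ ≡ ι m *ₒ det A →
    (∀ x → Twisted (det A) x → Σ ℤ λ s → x ≡ ι s *ₒ ρ) → ∣ m ∣ ≡ 1
  twisted⊆ℤρ⇒∣m∣≡1 A@(mat a b c e) U ρ m ρ²≡m·u twisted⊆ℤρ =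
    ℕP.m*n≡1⇒n≡1 ∣ k ∣ ∣ m ∣ (trans (sym (ℤP.abs-* k m)) (cong ∣_∣ (cong re ι[km]≡1)))
    where
    open UnitaryEntries U
    u = det A
    coeff : ∀ {x} → Twisted u x → ℤ
    coeff t = proj₁ (twisted⊆ℤρ _ t)
    coeff-spec : ∀ {x} (t : Twisted u x) → x ≡ ι (coeff t) *ₒ ρ
    coeff-spec t = proj₂ (twisted⊆ℤρ _ t)
    sa = coeff twisted₁₁
    sb = coeff twisted₁₂
    sc = coeff twisted₂₁
    se = coeff twisted₂₂
    k = sa * se - sb * sc
    u≡k·m·u : u ≡ ι k *ₒ (ι m *ₒ u)
    u≡k·m·u = begin
      u                                                          ≡⟨ cong det (mat-cong (coeff-spec twisted₁₁) (coeff-spec twisted₁₂)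
                                                                                       (coeff-spec twisted₂₁) (coeff-spec twisted₂₂)) ⟩
      det (mat (ι sa *ₒ ρ) (ι sb *ₒ ρ) (ι sc *ₒ ρ) (ι se *ₒ ρ))  ≡⟨ solve 5 (λ a b c e r → (a :* r) :* (e :* r) :+ :- ((b :* r) :* (c :* r))
                                                                                 := (a :* e :+ :- (b :* c)) :* (r :* r))
                                                                       refl (ι sa) (ι sb) (ι sc) (ι se) ρ ⟩
      (ι sa *ₒ ι se +ₒ -ₒ (ι sb *ₒ ι sc)) *ₒ (ρ *ₒ ρ)            ≡⟨ cong₂ (λ x y → (x +ₒ -ₒ y) *ₒ (ρ *ₒ ρ)) (ι-* sa se) (ι-* sb sc) ⟨
      ι k *ₒ (ρ *ₒ ρ)                                            ≡⟨ cong (ι k *ₒ_) ρ²≡m·u ⟩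
      ι k *ₒ (ι m *ₒ u)                                          ∎
    ι[km]≡1 : ι (k * m) ≡ 1ₒ
    ι[km]≡1 = begin
      ι (k * m)                       ≡⟨ ι-* k m ⟩
      ι k *ₒ ι m                      ≡⟨ *ₒ-identityʳ _ ⟨
      (ι k *ₒ ι m) *ₒ 1ₒ              ≡⟨ cong ((ι k *ₒ ι m) *ₒ_) det-unitary ⟨
      (ι k *ₒ ι m) *ₒ (u *ₒ conj u)   ≡⟨ solve 4 (λ k m u ū → (k :* m) :* (u :* ū) := (k :* (m :* u)) :* ū) refl (ι k) (ι m) u (conj u) ⟩
      (ι k *ₒ (ι m *ₒ u)) *ₒ conj u   ≡⟨ cong (_*ₒ conj u) u≡k·m·u ⟨
      u *ₒ conj u                     ≡⟨ det-unitary ⟩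
      1ₒ                              ∎

module DeterminantSquare (d : ℕ) where
  open OK d hiding (_*)
  open Arithmetic d
  open Units d
  open Unitary d

  -- Multiplication, conjugation and powers with tr and nm replaced by t and n. For t = tr and n = nm they
  -- agree definitionally with _*ₒ_ and conj, and for numerals t, n they evaluate on explicit elements.
  mulAt : ℤ → ℤ → 𝒪 → 𝒪 → 𝒪
  mulAt t n (mk a b) (mk c e) = mk (a * c - n * (b * e)) (a * e + b * c + t * (b * e))

  conjAt : ℤ → 𝒪 → 𝒪
  conjAt t (mk a b) = mk (a + t * b) (- b)

  powAt : ℤ → ℤ → 𝒪 → ℕ → 𝒪
  powAt t n x ℕ.zero    = 1ₒ
  powAt t n x (ℕ.suc k) = mulAt t n x (powAt t n x k)

  ^ₒ≡powAt : ∀ {t n} → tr ≡ t → nm ≡ n → ∀ x k → x ^ₒ k ≡ powAt t n x k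
  ^ₒ≡powAt refl refl x ℕ.zero    = refl
  ^ₒ≡powAt refl refl x (ℕ.suc k) = cong (x *ₒ_) (^ₒ≡powAt refl refl x k)

  SquareRoot : 𝒪 → Set
  SquareRoot u = Σ 𝒪 λ ζ → RootOfUnity ζ × ζ *ₒ ζ ≡ u

  square-root-at : ∀ {t n u} → tr ≡ t → nm ≡ n → ∀ ζ k → 1 ≤ k →
    powAt t n ζ k ≡ 1ₒ → mulAt t n ζ ζ ≡ u → SquareRoot u
  square-root-at refl refl ζ k 1≤k ζᵏ≡1 ζ²≡u = ζ , (k , 1≤k , trans (^ₒ≡powAt refl refl ζ k) ζᵏ≡1) , ζ²≡u

  spanned-by : ∀ {x} ρ s → re x ≡ s * re ρ → im x ≡ s * im ρ → Σ ℤ λ s → x ≡ ι s *ₒ ρ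
  spanned-by {mk p q} ρ s p≡sa q≡sb = s , trans (cong₂ mk p≡sa q≡sb) (sym (ι-*ₒ s ρ))

  √1 : SquareRoot 1ₒ
  √1 = 1ₒ , (1 , s≤s z≤n , *ₒ-identityˡ 1ₒ) , *ₒ-identityˡ 1ₒ

  √-1 : ¬ d % 4 ≡ 3 → d ≡ 1 → SquareRoot -1ₒ
  √-1 h d≡1 = square-root-at (tr≡0 h) (trans (nm≡d h) (cong +_ d≡1)) (mk (+ 0) (+ 1)) 4 (s≤s z≤n) refl refl

  √ω² : d % 4 ≡ 3 → d ≡ 3 → SquareRoot (mk -[1+ 0 ] (+ 1))
  √ω² h d≡3 = square-root-at (tr≡1 h) (d≡3⇒nm≡1 h d≡3) (mk (+ 0) (+ 1)) 6 (s≤s z≤n) refl refl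

  √ω⁴ : d % 4 ≡ 3 → d ≡ 3 → SquareRoot (mk (+ 0) -[1+ 0 ])
  √ω⁴ h d≡3 = square-root-at (tr≡1 h) (d≡3⇒nm≡1 h d≡3) (mk -[1+ 0 ] (+ 1)) 3 (s≤s z≤n) refl refl

  module _ (A : Mat) (U : UnitaryEntries A) where

    obstruction-at : ∀ {t n u} → tr ≡ t → nm ≡ n → det A ≡ u → ∀ ρ m →
      mulAt t n ρ ρ ≡ mulAt t n (ι m) u →
      (∀ p q → mk p q ≡ mulAt t n u (conjAt t (mk p q)) → Σ ℤ λ s → mk p q ≡ ι s *ₒ ρ) → ∣ m ∣ ≡ 1
    obstruction-at refl refl refl ρ m ρ²≡m·u spans = twisted⊆ℤρ⇒∣m∣≡1 A U ρ m ρ²≡m·u (λ { (mk p q) → spans p q })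

    -- For d ≢ 3 (mod 4) the solutions of x = -x̄ are the multiples of √-d.
    det≡-1⇒d≡1 : ¬ d % 4 ≡ 3 → det A ≡ -1ₒ → d ≡ 1
    det≡-1⇒d≡1 h u≡-1 = obstruction-at (tr≡0 h) (nm≡d h) u≡-1 (mk (+ 0) (+ 1)) (+ d)
      (cong₂ mk (re-square (+ d)) (im-square (+ d))) spans
      where
      re-square : ∀ D → + 0 * + 0 - D * (+ 1 * + 1) ≡ D * -[1+ 0 ] - D * (+ 0 * + 0)
      re-square = solve-∀
      im-square : ∀ D → + 0 * + 1 + + 1 * + 0 + + 0 * (+ 1 * + 1) ≡ D * + 0 + + 0 * -[1+ 0 ] + + 0 * (+ 0 * + 0)
      im-square = solve-∀
      re-twisted : ∀ p q D → -[1+ 0 ] * (p + + 0 * q) - D * (+ 0 * - q) ≡ - p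
      re-twisted = solve-∀
      spans : ∀ p q → mk p q ≡ mulAt (+ 0) (+ d) -1ₒ (conjAt (+ 0) (mk p q)) → Σ ℤ λ s → mk p q ≡ ι s *ₒ mk (+ 0) (+ 1)
      spans p q tw = spanned-by (mk (+ 0) (+ 1)) q (trans p≡0 (sym (ℤP.*-zeroʳ q))) (sym (ℤP.*-identityʳ q))
        where
        p≡0 : p ≡ + 0
        p≡0 = -i≡i⇒i≡0 p (sym (trans (cong re tw) (re-twisted p q (+ d))))

    -- For d ≡ 3 (mod 4) the solutions of x = -x̄ are the multiples of 1 - 2ω = -√-d.
    det≢-1 : d % 4 ≡ 3 → det A ≡ -1ₒ → ⊥
    det≢-1 h u≡-1 = 1≢3 (trans (cong (_% 4) (sym d≡1)) h)
      where
      j = d / 4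
      n = + 1 + + j
      1≢3 : ¬ 1 ≡ 3
      1≢3 ()
      re-square : ∀ j → + 1 * + 1 - (+ 1 + j) * (-[1+ 1 ] * -[1+ 1 ]) ≡ (+ 3 + + 4 * j) * -[1+ 0 ] - (+ 1 + j) * (+ 0 * + 0)
      re-square = solve-∀
      im-square : ∀ j → + 1 * -[1+ 1 ] + -[1+ 1 ] * + 1 + + 1 * (-[1+ 1 ] * -[1+ 1 ]) ≡
                          (+ 3 + + 4 * j) * + 0 + + 0 * -[1+ 0 ] + + 1 * (+ 0 * + 0)
      im-square = solve-∀
      ρ² : mulAt (+ 1) n (mk (+ 1) -[1+ 1 ]) (mk (+ 1) -[1+ 1 ]) ≡ mulAt (+ 1) n (ι (+ d)) -1ₒ
      ρ² = trans (cong₂ mk (re-square (+ j)) (im-square (+ j))) (cong (λ D → mulAt (+ 1) n (ι D) -1ₒ) (sym (+d≡3+4[d/4] h)))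
      re-twisted : ∀ n p q → -[1+ 0 ] * (p + + 1 * q) - n * (+ 0 * - q) ≡ - p - q
      re-twisted = solve-∀
      q≡-2p : ∀ p q → p ≡ - p - q → q ≡ p * -[1+ 1 ]
      q≡-2p p q p≡-p-q = begin
        q                ≡⟨ e₁ p q ⟩
        - p - (- p - q)  ≡⟨ cong (λ r → - p - r) p≡-p-q ⟨
        - p - p          ≡⟨ e₂ p ⟩
        p * -[1+ 1 ]     ∎
        where
        e₁ : ∀ p q → q ≡ - p - (- p - q)
        e₁ = solve-∀
        e₂ : ∀ p → - p - p ≡ p * -[1+ 1 ]
        e₂ = solve-∀
      spans : ∀ p q → mk p q ≡ mulAt (+ 1) n -1ₒ (conjAt (+ 1) (mk p q)) → Σ ℤ λ s → mk p q ≡ ι s *ₒ mk (+ 1) -[1+ 1 ]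
      spans p q tw = spanned-by (mk (+ 1) -[1+ 1 ]) p (sym (ℤP.*-identityʳ p)) (q≡-2p p q (trans (cong re tw) (re-twisted n p q)))
      d≡1 : d ≡ 1
      d≡1 = obstruction-at (tr≡1 h) (nm≡1+[d/4] h) u≡-1 (mk (+ 1) -[1+ 1 ]) (+ d) ρ² spans

    2≢1 : ¬ ∣ + 2 ∣ ≡ 1
    2≢1 ()

    3≢1 : ¬ ∣ + 3 ∣ ≡ 1
    3≢1 ()

    -- For d = 1 the solutions of x = ± i x̄ are the multiples of 1 ± i, and (1 ± i)² = ± 2i.
    det≢i : ¬ d % 4 ≡ 3 → d ≡ 1 → det A ≡ mk (+ 0) (+ 1) → ⊥
    det≢i h d≡1 u≡i = 2≢1 (obstruction-at (tr≡0 h) (trans (nm≡d h) (cong +_ d≡1)) u≡i (mk (+ 1) (+ 1)) (+ 2) refl spans)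
      where
      re-twisted : ∀ p q → + 0 * (p + + 0 * q) - + 1 * (+ 1 * - q) ≡ q
      re-twisted = solve-∀
      spans : ∀ p q → mk p q ≡ mulAt (+ 0) (+ 1) (mk (+ 0) (+ 1)) (conjAt (+ 0) (mk p q)) →
        Σ ℤ λ s → mk p q ≡ ι s *ₒ mk (+ 1) (+ 1)
      spans p q tw = spanned-by (mk (+ 1) (+ 1)) p (sym (ℤP.*-identityʳ p))
        (trans (sym (trans (cong re tw) (re-twisted p q))) (sym (ℤP.*-identityʳ p)))

    det≢-i : ¬ d % 4 ≡ 3 → d ≡ 1 → det A ≡ mk (+ 0) -[1+ 0 ] → ⊥
    det≢-i h d≡1 u≡-i = 2≢1 (obstruction-at (tr≡0 h) (trans (nm≡d h) (cong +_ d≡1)) u≡-i (mk (+ 1) -[1+ 0 ]) (+ 2) refl spans)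
      where
      re-twisted : ∀ p q → + 0 * (p + + 0 * q) - + 1 * (-[1+ 0 ] * - q) ≡ - q
      re-twisted = solve-∀
      q≡-p : ∀ p q → p ≡ - q → q ≡ p * -[1+ 0 ]
      q≡-p p q p≡-q = trans (sym (ℤP.neg-involutive q)) (trans (cong -_ (sym p≡-q)) (trans (sym (ℤP.-1*i≡-i p)) (ℤP.*-comm -[1+ 0 ] p)))
      spans : ∀ p q → mk p q ≡ mulAt (+ 0) (+ 1) (mk (+ 0) -[1+ 0 ]) (conjAt (+ 0) (mk p q)) →
        Σ ℤ λ s → mk p q ≡ ι s *ₒ mk (+ 1) -[1+ 0 ]
      spans p q tw = spanned-by (mk (+ 1) -[1+ 0 ]) p (sym (ℤP.*-identityʳ p)) (q≡-p p q (trans (cong re tw) (re-twisted p q)))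

    -- For d = 3 the solutions of x = ω x̄ are the multiples of 1 + ω, with (1 + ω)² = 3ω,
    -- and those of x = ω⁵ x̄ are the multiples of ω - 2, with (ω - 2)² = 3ω⁵.
    det≢ω : d % 4 ≡ 3 → d ≡ 3 → det A ≡ mk (+ 0) (+ 1) → ⊥
    det≢ω h d≡3 u≡ω = 3≢1 (obstruction-at (tr≡1 h) (d≡3⇒nm≡1 h d≡3) u≡ω (mk (+ 1) (+ 1)) (+ 3) refl spans)
      where
      re-twisted : ∀ p q → + 0 * (p + + 1 * q) - + 1 * (+ 1 * - q) ≡ q
      re-twisted = solve-∀
      spans : ∀ p q → mk p q ≡ mulAt (+ 1) (+ 1) (mk (+ 0) (+ 1)) (conjAt (+ 1) (mk p q)) →
        Σ ℤ λ s → mk p q ≡ ι s *ₒ mk (+ 1) (+ 1)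
      spans p q tw = spanned-by (mk (+ 1) (+ 1)) p (sym (ℤP.*-identityʳ p))
        (trans (sym (trans (cong re tw) (re-twisted p q))) (sym (ℤP.*-identityʳ p)))

    det≢ω⁵ : d % 4 ≡ 3 → d ≡ 3 → det A ≡ mk (+ 1) -[1+ 0 ] → ⊥
    det≢ω⁵ h d≡3 u≡ω⁵ = 3≢1 (obstruction-at (tr≡1 h) (d≡3⇒nm≡1 h d≡3) u≡ω⁵ (mk -[1+ 1 ] (+ 1)) (+ 3) refl spans)
      where
      im-twisted : ∀ p q → + 1 * - q + -[1+ 0 ] * (p + + 1 * q) + + 1 * (-[1+ 0 ] * - q) ≡ - p - q
      im-twisted = solve-∀
      p≡-2q : ∀ p q → q ≡ - p - q → p ≡ q * -[1+ 1 ]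
      p≡-2q p q q≡-p-q = begin
        p                ≡⟨ e₁ p q ⟩
        - q - (- p - q)  ≡⟨ cong (λ r → - q - r) q≡-p-q ⟨
        - q - q          ≡⟨ e₂ q ⟩
        q * -[1+ 1 ]     ∎
        where
        e₁ : ∀ p q → p ≡ - q - (- p - q)
        e₁ = solve-∀
        e₂ : ∀ q → - q - q ≡ q * -[1+ 1 ]
        e₂ = solve-∀
      spans : ∀ p q → mk p q ≡ mulAt (+ 1) (+ 1) (mk (+ 1) -[1+ 0 ]) (conjAt (+ 1) (mk p q)) →
        Σ ℤ λ s → mk p q ≡ ι s *ₒ mk -[1+ 1 ] (+ 1)
      spans p q tw = spanned-by (mk -[1+ 1 ] (+ 1)) q (p≡-2q p q (trans (cong im tw) (im-twisted p q))) (sym (ℤP.*-identityʳ q))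

    square-root-of-det : 1 ≤ d → SquareRoot (det A)
    square-root-of-det 1≤d = by-cases (d % 4 ℕ.≟ 3)
      where
      N-det≡1 : N (det A) ≡ + 1
      N-det≡1 = cong re (UnitaryEntries.det-unitary U)
      via : ∀ {u} → det A ≡ u → SquareRoot u → SquareRoot (det A)
      via u≡ = subst SquareRoot (sym u≡)
      by-cases : Dec (d % 4 ≡ 3) → SquareRoot (det A)
      by-cases (no h) with units-when-tr≡0 1≤d h (det A) N-det≡1
      ... | inj₁ u≡1                      = via u≡1 √1
      ... | inj₂ (inj₁ u≡-1)              = via u≡-1 (√-1 h (det≡-1⇒d≡1 h u≡-1))
      ... | inj₂ (inj₂ (d≡1 , inj₁ u≡i))  = ⊥-elim (det≢i h d≡1 u≡i)
      ... | inj₂ (inj₂ (d≡1 , inj₂ u≡-i)) = ⊥-elim (det≢-i h d≡1 u≡-i)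
      by-cases (yes h) with units-when-tr≡1 h (det A) N-det≡1
      ... | inj₁ u≡1                                         = via u≡1 √1
      ... | inj₂ (inj₁ u≡-1)                                 = ⊥-elim (det≢-1 h u≡-1)
      ... | inj₂ (inj₂ (d≡3 , inj₁ u≡ω))                     = ⊥-elim (det≢ω h d≡3 u≡ω)
      ... | inj₂ (inj₂ (d≡3 , inj₂ (inj₁ u≡ω²)))             = via u≡ω² (√ω² h d≡3)
      ... | inj₂ (inj₂ (d≡3 , inj₂ (inj₂ (inj₁ u≡ω⁴))))      = via u≡ω⁴ (√ω⁴ h d≡3)
      ... | inj₂ (inj₂ (d≡3 , inj₂ (inj₂ (inj₂ u≡ω⁵))))      = ⊥-elim (det≢ω⁵ h d≡3 u≡ω⁵)

module Characterisation (d : ℕ) where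
  open OK d hiding (_*)
  open Arithmetic d
  open Units d
  open Unitary d
  open DeterminantSquare d

  scal-1ₒ : ∀ B → scal 1ₒ B ≡ B
  scal-1ₒ (mat a b c e) = mat-cong (*ₒ-identityˡ a) (*ₒ-identityˡ b) (*ₒ-identityˡ c) (*ₒ-identityˡ e)

  SU11⇒SL₂ℤ : ∀ A → SU11 A → SL₂ℤ A
  SU11⇒SL₂ℤ A@(mat a b c e) ((_ , AJAᴴ≡J) , det≡1) =
    (re a , re b , re c , re e , mat-cong (integral twisted₁₁) (integral twisted₁₂) (integral twisted₂₁) (integral twisted₂₂)) ,
    det≡1
    where
    open UnitaryEntries (unitary⇒entries A AJAᴴ≡J)
    integral : ∀ {x} → Twisted (det A) x → x ≡ ι (re x)
    integral {x} x≡ux̄ = conj-fixed⇒ι x (sym (trans x≡ux̄ (trans (cong (_*ₒ conj x) det≡1) (*ₒ-identityˡ (conj x)))))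

  SL₂ℤ⇒SU11 : ∀ A → SL₂ℤ A → SU11 A
  SL₂ℤ⇒SU11 A A∈SL₂ℤ@(_ , det≡1) = subst U11 (scal-1ₒ A) (scal-SL₂ℤ-unitary 1ₒ A 1̄·1≡1 A∈SL₂ℤ) , det≡1
    where
    1̄·1≡1 : conj 1ₒ *ₒ 1ₒ ≡ 1ₒ
    1̄·1≡1 = trans (cong (_*ₒ 1ₒ) (conj-ι (+ 1))) (*ₒ-identityˡ 1ₒ)

  ScalarSL₂ℤ : Mat → Set
  ScalarSL₂ℤ A = Σ 𝒪 λ ζ → Σ Mat λ B → RootOfUnity ζ × SL₂ℤ B × (A ≡ scal ζ B)

  U11⇒ScalarSL₂ℤ : 1 ≤ d → ∀ A → U11 A → ScalarSL₂ℤ A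
  U11⇒ScalarSL₂ℤ 1≤d A (_ , AJAᴴ≡J) = decompose (square-root-of-det A U 1≤d)
    where
    U = unitary⇒entries A AJAᴴ≡J
    decompose : SquareRoot (det A) → ScalarSL₂ℤ A
    decompose (ζ , ζ-root , ζ²≡u) =
      let B , B∈SL₂ℤ , A≡ζB = scalar-decomposition A U ζ (root-of-unity⇒unitary ζ ζ-root) ζ²≡u
      in ζ , B , ζ-root , B∈SL₂ℤ , A≡ζB

  ScalarSL₂ℤ⇒U11 : ∀ A → ScalarSL₂ℤ A → U11 A
  ScalarSL₂ℤ⇒U11 A (ζ , B , ζ-root , B∈SL₂ℤ , A≡ζB) =
    subst U11 (sym A≡ζB) (scal-SL₂ℤ-unitary ζ B (root-of-unity⇒unitary ζ ζ-root) B∈SL₂ℤ)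

lemma2p2 : (d : ℕ) → 1 ≤ d → SquareFree d →
    ((A : OK.Mat d) → OK.SU11 d A ⇔ OK.SL₂ℤ d A)
    × ((A : OK.Mat d) → OK.U11 d A ⇔
        (Σ (OK.𝒪 d) λ ζ → Σ (OK.Mat d) λ B →
          OK.RootOfUnity d ζ × OK.SL₂ℤ d B × (A ≡ OK.scal d ζ B)))
lemma2p2 d 1≤d _ =
  (λ A → mk⇔ (SU11⇒SL₂ℤ A) (SL₂ℤ⇒SU11 A)) ,
  (λ A → mk⇔ (U11⇒ScalarSL₂ℤ 1≤d A) (ScalarSL₂ℤ⇒U11 A))
  where open Characterisation d
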